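{- Let $k$ and $n$ be positive integers and let $n^{\overline{k}}=\prod_{i=0}^{k-1}(n+i)$ be the rising factorial. Define $r=\left\lfloor\frac{k^2-4k+6}{4}\right\rfloor$ if $k$ is even and $r=\left\lfloor\frac{k^2-6k+11}{4}\right\rfloor$ if $k$ is odd. If $n\ge r$, then $$\left(n+\left\lfloor\tfrac{k}{2}\right\rfloor-1\right)^k\le n^{\overline{k}}\le\left(n+\left\lfloor\tfrac{k}{2}\right\rfloor\right)^k.$$ -}

module Defs where

open import Data.Nat using (ℕ; zero; suc; _+_; _*_; _∸_; _/_)
open import Data.Nat.Base using (_%_)
open import Data.Bool using (Bool; true; false; if_then_else_)
open import Data.Nat using (_≡ᵇ_)

_^↑_ : ℕ → ℕ → ℕ
n ^↑ zero = 1
n ^↑ suc k = (n ^↑ k) * (n + k)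

-- threshold r(k); the numerators k²-4k+6 = (k-2)²+2 and k²-6k+11 = (k-3)²+2
-- are always positive, so truncated subtraction is exact here.
r : ℕ → ℕ
r k = if (k % 2) ≡ᵇ 0
        then ((k * k + 6) ∸ 4 * k) / 4
        else ((k * k + 11) ∸ 6 * k) / 4

{-# OPTIONS --safe #-}
module Submission where

open import Defs
open import Data.Nat using (ℕ; _+_; _∸_; _^_; _≤_; _/_; NonZero)
open import Data.Product using (_×_; _,_)
open import Data.Nat using (zero; suc; _*_; _%_; z≤n; s≤s; s≤s⁻¹)
open import Data.Nat.Properties
open import Data.Nat.DivMod
  using (m*n%n≡0; [m+kn]%n≡m%n; m*n/n≡m; m/n*n≤m; m≡m%n+[m/n]*n; m%n<n; m/n≡1+[m∸n]/n; /-congˡ; +-distrib-/-∣ʳ)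
open import Data.Nat.Divisibility using (divides-refl)
open import Data.Nat.Tactic.RingSolver using (solve-∀)
open import Relation.Binary.PropositionalEquality using (_≡_; sym; trans; cong; subst; module ≡-Reasoning)

-- Write h = ⌊k/2⌋ and peel off the outermost factors n and n + k − 1 of the
-- rising factorial: what remains is (n+1)^↑(k−2), and ⌊(k−2)/2⌋ = h − 1, so both bounds
-- follow by induction on k in steps of two, with n replaced by n + 1. For the outer pair,
-- AM–GM gives n(n + k − 1) ≤ n(n + 2h) ≤ (n + h)², and conversely
-- (n + h − 1)² ≤ n(n + 2h − 1) ≤ n(n + k − 1) as soon as (h − 1)² ≤ n. The threshold r(k)
-- is exactly (h − 1)² for k ≥ 2, and the conditions needed further inside are weaker.

^↑-unfoldˡ : ∀ n k → n ^↑ suc k ≡ n * (suc n ^↑ k)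
^↑-unfoldˡ n zero = trans (*-identityˡ (n + 0)) (trans (+-identityʳ n) (sym (*-identityʳ n)))
^↑-unfoldˡ n (suc k) = begin
  n ^↑ suc k * (n + suc k)         ≡⟨ cong (_* (n + suc k)) (^↑-unfoldˡ n k) ⟩
  n * (suc n ^↑ k) * (n + suc k)   ≡⟨ *-assoc n (suc n ^↑ k) (n + suc k) ⟩
  n * (suc n ^↑ k * (n + suc k))   ≡⟨ cong (λ m → n * (suc n ^↑ k * m)) (+-suc n k) ⟩
  n * (suc n ^↑ suc k)             ∎
  where open ≡-Reasoning

^↑-peel : ∀ n k → n ^↑ (2 + k) ≡ n * (n + suc k) * (suc n ^↑ k)
^↑-peel n k = begin
  n ^↑ suc k * (n + suc k)         ≡⟨ cong (_* (n + suc k)) (^↑-unfoldˡ n k) ⟩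
  n * (suc n ^↑ k) * (n + suc k)   ≡⟨ *-assoc n (suc n ^↑ k) (n + suc k) ⟩
  n * (suc n ^↑ k * (n + suc k))   ≡⟨ cong (n *_) (*-comm (suc n ^↑ k) (n + suc k)) ⟩
  n * ((n + suc k) * suc n ^↑ k)   ≡⟨ *-assoc n (n + suc k) (suc n ^↑ k) ⟨
  n * (n + suc k) * (suc n ^↑ k)   ∎
  where open ≡-Reasoning

k≤1+k/2*2 : ∀ k → k ≤ suc (k / 2 * 2)
k≤1+k/2*2 k = begin
  k                  ≡⟨ m≡m%n+[m/n]*n k 2 ⟩
  k % 2 + k / 2 * 2  ≤⟨ +-monoˡ-≤ (k / 2 * 2) (s≤s⁻¹ (m%n<n k 2)) ⟩
  suc (k / 2 * 2)    ∎
  where open ≤-Reasoning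

[2+k]/2≡1+k/2 : ∀ k → (2 + k) / 2 ≡ suc (k / 2)
[2+k]/2≡1+k/2 k = m/n≡1+[m∸n]/n {2 + k} {2} (s≤s (s≤s z≤n))

n+[2+k]/2≡1+n+k/2 : ∀ n k → n + (2 + k) / 2 ≡ suc n + k / 2
n+[2+k]/2≡1+n+k/2 n k = trans (cong (n +_) ([2+k]/2≡1+k/2 k)) (+-suc n (k / 2))

n*[n+1+k]≤[1+n+h]² : ∀ n h {k} → k ≤ suc (h * 2) → n * (n + suc k) ≤ (suc n + h) * (suc n + h)
n*[n+1+k]≤[1+n+h]² n h {k} k≤1+2h = begin
  n * (n + suc k)                                 ≤⟨ *-monoʳ-≤ n (+-monoʳ-≤ n (s≤s k≤1+2h)) ⟩
  n * (n + suc (suc (h * 2)))                     ≤⟨ m≤m+n _ (suc h * suc h) ⟩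
  n * (n + suc (suc (h * 2))) + suc h * suc h     ≡⟨ square-expansion n h ⟩
  (suc n + h) * (suc n + h)                       ∎
  where
  open ≤-Reasoning
  square-expansion : ∀ n h → n * (n + suc (suc (h * 2))) + suc h * suc h ≡ (suc n + h) * (suc n + h)
  square-expansion = solve-∀

[n+h]²≤n*[n+1+k] : ∀ n h {k} → h * h ≤ n → h * 2 ≤ k → (n + h) * (n + h) ≤ n * (n + suc k)
[n+h]²≤n*[n+1+k] n h {k} h²≤n 2h≤k = begin
  (n + h) * (n + h)                    ≡⟨ square-expansion n h ⟩
  n * (n + h * 2) + h * h              ≤⟨ +-monoʳ-≤ (n * (n + h * 2)) h²≤n ⟩
  n * (n + h * 2) + n                  ≡⟨ distribution n h ⟩
  n * (n + suc (h * 2))                ≤⟨ *-monoʳ-≤ n (+-monoʳ-≤ n (s≤s 2h≤k)) ⟩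
  n * (n + suc k)                      ∎
  where
  open ≤-Reasoning
  square-expansion : ∀ n h → (n + h) * (n + h) ≡ n * (n + h * 2) + h * h
  square-expansion = solve-∀
  distribution : ∀ n h → n * (n + h * 2) + n ≡ n * (n + suc (h * 2))
  distribution = solve-∀

^↑≤[n+k/2]^k : ∀ k n → n ^↑ k ≤ (n + k / 2) ^ k
^↑≤[n+k/2]^k zero n = ≤-refl
^↑≤[n+k/2]^k (suc zero) n = ≤-reflexive (trans (*-identityˡ (n + 0)) (sym (*-identityʳ (n + 0))))
^↑≤[n+k/2]^k (suc (suc k)) n = begin
  n ^↑ (2 + k)                               ≡⟨ ^↑-peel n k ⟩
  n * (n + suc k) * (suc n ^↑ k)
    ≤⟨ *-mono-≤ (n*[n+1+k]≤[1+n+h]² n h (k≤1+k/2*2 k)) (^↑≤[n+k/2]^k k (suc n)) ⟩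
  (suc n + h) * (suc n + h) * (suc n + h) ^ k ≡⟨ *-assoc (suc n + h) (suc n + h) ((suc n + h) ^ k) ⟩
  (suc n + h) ^ (2 + k)                      ≡⟨ cong (_^ (2 + k)) (n+[2+k]/2≡1+n+k/2 n k) ⟨
  (n + (2 + k) / 2) ^ (2 + k)                ∎
  where
  open ≤-Reasoning
  h = k / 2

[n+k/2∸1]^k≤^↑ : ∀ k n → (k / 2 ∸ 1) * (k / 2 ∸ 1) ≤ n → (n + k / 2 ∸ 1) ^ k ≤ n ^↑ k
[n+k/2∸1]^k≤^↑ zero n _ = ≤-refl
[n+k/2∸1]^k≤^↑ (suc zero) n _ =
  ≤-trans (≤-reflexive (*-identityʳ (n + 0 ∸ 1))) (≤-trans (m∸n≤m (n + 0) 1) (m≤n*m (n + 0) 1))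
[n+k/2∸1]^k≤^↑ (suc (suc k)) n [h+1∸1]²≤n = begin
  (n + (2 + k) / 2 ∸ 1) ^ (2 + k)            ≡⟨ cong (λ m → (m ∸ 1) ^ (2 + k)) (n+[2+k]/2≡1+n+k/2 n k) ⟩
  (n + h) ^ (2 + k)                          ≡⟨ *-assoc (n + h) (n + h) ((n + h) ^ k) ⟨
  (n + h) * (n + h) * (n + h) ^ k
    ≤⟨ *-mono-≤ ([n+h]²≤n*[n+1+k] n h h²≤n (m/n*n≤m k 2)) ih ⟩
  n * (n + suc k) * (suc n ^↑ k)             ≡⟨ ^↑-peel n k ⟨
  n ^↑ (2 + k)                               ∎
  where
  open ≤-Reasoning
  h = k / 2
  h²≤n : h * h ≤ n
  h²≤n = subst (λ m → m * m ≤ n) (cong (_∸ 1) ([2+k]/2≡1+k/2 k)) [h+1∸1]²≤n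
  ih : (n + h) ^ k ≤ suc n ^↑ k
  ih = [n+k/2∸1]^k≤^↑ k (suc n)
    (≤-trans (*-mono-≤ (m∸n≤m h 1) (m∸n≤m h 1)) (≤-trans h²≤n (n≤1+n n)))

[2+t²*4]/4≡t² : ∀ t → (2 + t * t * 4) / 4 ≡ t * t
[2+t²*4]/4≡t² t = trans (+-distrib-/-∣ʳ 2 {d = 4} (divides-refl (t * t))) (m*n/n≡m (t * t) 4)

r[2+2t]≡t² : ∀ t → r (2 + t * 2) ≡ t * t
r[2+2t]≡t² t rewrite m*n%n≡0 t 2 ⦃ _ ⦄ = trans (/-congˡ numerator) ([2+t²*4]/4≡t² t)
  where
  expansion : ∀ t → (2 + t * 2) * (2 + t * 2) + 6 ≡ (2 + t * t * 4) + 4 * (2 + t * 2)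
  expansion = solve-∀
  numerator : (2 + t * 2) * (2 + t * 2) + 6 ∸ 4 * (2 + t * 2) ≡ 2 + t * t * 4
  numerator = trans (cong (_∸ 4 * (2 + t * 2)) (expansion t))
                    (m+n∸n≡m (2 + t * t * 4) (4 * (2 + t * 2)))

r[3+2t]≡t² : ∀ t → r (3 + t * 2) ≡ t * t
r[3+2t]≡t² t rewrite [m+kn]%n≡m%n 1 t 2 ⦃ _ ⦄ = trans (/-congˡ numerator) ([2+t²*4]/4≡t² t)
  where
  expansion : ∀ t → (3 + t * 2) * (3 + t * 2) + 11 ≡ (2 + t * t * 4) + 6 * (3 + t * 2)
  expansion = solve-∀
  numerator : (3 + t * 2) * (3 + t * 2) + 11 ∸ 6 * (3 + t * 2) ≡ 2 + t * t * 4
  numerator = trans (cong (_∸ 6 * (3 + t * 2)) (expansion t))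
                    (m+n∸n≡m (2 + t * t * 4) (6 * (3 + t * 2)))

data Parity : ℕ → Set where
  even : ∀ t → Parity (t * 2)
  odd  : ∀ t → Parity (suc (t * 2))

parity : ∀ n → Parity n
parity zero = even zero
parity (suc n) with parity n
... | even t = odd t
... | odd t  = even (suc t)

[1+2t]/2≡t : ∀ t → suc (t * 2) / 2 ≡ t
[1+2t]/2≡t t = trans (+-distrib-/-∣ʳ 1 {d = 2} (divides-refl t)) (m*n/n≡m t 2)

[k/2∸1]²≤r : ∀ k → (k / 2 ∸ 1) * (k / 2 ∸ 1) ≤ r k
[k/2∸1]²≤r k with parity k
... | even zero    = z≤n
... | odd zero     = z≤n
... | even (suc t) = subst (λ h → (h ∸ 1) * (h ∸ 1) ≤ r (2 + t * 2)) (sym (m*n/n≡m (suc t) 2))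
                       (≤-reflexive (sym (r[2+2t]≡t² t)))
... | odd (suc t)  = subst (λ h → (h ∸ 1) * (h ∸ 1) ≤ r (3 + t * 2)) (sym ([1+2t]/2≡t (suc t)))
                       (≤-reflexive (sym (r[3+2t]≡t² t)))

lemma1 : (k n : ℕ) → .{{_ : NonZero k}} → .{{_ : NonZero n}} → r k ≤ n → ((n + k / 2) ∸ 1) ^ k ≤ n ^↑ k × n ^↑ k ≤ (n + k / 2) ^ k
lemma1 k n r≤n = [n+k/2∸1]^k≤^↑ k n (≤-trans ([k/2∸1]²≤r k) r≤n) , ^↑≤[n+k/2]^k k n
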